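{- For all $n,d,x$ for which the caterpillars below are defined, $W(G_{3}(n,d,x,1))=W(G_{3}(n,d,x,0))+2$.
   Context: For a connected graph $G$, $W(G)=\sum_{\{u,v\}\subseteq V(G)} d_G(u,v)$ (sum over unordered pairs). Caterpillar $B_1(m,d,x)$: for even $m\ge 18$ and positive integers $d,x$ with $\lceil\frac{m-2}{4}\rceil\le d\le\frac{m-8}{2}$ and $x\le\frac{4+4d-m}{2}$, take the path $u_{ -d}\ldots u_{ -1}u_0u_1\ldots u_d$, append one leaf to each of $u_{ -d-1+x}$ and $u_{d+1-x}$, and append one leaf to each of $u_{ -(k-1)},\ldots,u_{k-1}$, where $k=\frac{m-(2d+1)-1}{2}$. For odd $n$ and integers $d,x$ for which $B_1(n-1,d,x)$ is defined, and $s\in\{0,1\}$, $G_3(n,d,x,s)$ is the caterpillar on $n$ vertices obtained from $B_1(n-1,d,x)$ by appending one leaf to $u_s$. -}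

module Defs where

open import Data.Nat using (ℕ; zero; suc; _+_; _*_; _∸_; _≡ᵇ_)
open import Data.Bool using (Bool; true; false; _∨_; _∧_; if_then_else_)
open import Data.List using (List; []; _∷_; _++_; map; upTo; concatMap; length)
open import Data.Nat.ListAction using (sum)
open import Data.Bool.ListAction using (any)
open import Data.Product using (_×_; _,_)
open import Relation.Binary.PropositionalEquality using (_≡_)

-- Finite simple graphs on vertex set {0, …, N-1}, given by an edge list.

record Graph : Set where
  field
    N     : ℕ
    edges : List (ℕ × ℕ)
open Graph public

adj : Graph → ℕ → ℕ → Bool
adj G u v = any (λ e → let (a , b) = e in
                   ((a ≡ᵇ u) ∧ (b ≡ᵇ v)) ∨ ((a ≡ᵇ v) ∧ (b ≡ᵇ u))) (edges G)

reach : Graph → ℕ → ℕ → ℕ → Bool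
reach G zero    u v = u ≡ᵇ v
reach G (suc k) u v = reach G k u v ∨ any (λ w → reach G k u w ∧ adj G w v) (upTo (N G))

distFrom : Graph → ℕ → ℕ → ℕ → ℕ → ℕ
distFrom G u v k zero     = k
distFrom G u v k (suc f)  = if reach G k u v then k else distFrom G u v (suc k) f

-- graph distance d_G(u,v): the least length of a u–v walk.  In a connected
-- graph on N vertices this is < N, so fuel N suffices.
dist : Graph → ℕ → ℕ → ℕ
dist G u v = distFrom G u v 0 (N G)

wiener : Graph → ℕ
wiener G = sum (concatMap (λ v → map (λ u → dist G u v) (upTo v)) (upTo (N G)))

-- Caterpillars: spine path 0 - 1 - … - (L-1); the j-th entry a_j of the
-- attachment list gives a pendant vertex L+j adjacent to spine vertex a_j.

spineEdges : ℕ → List (ℕ × ℕ)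
spineEdges L = map (λ i → (i , suc i)) (upTo (L ∸ 1))

leafEdges : ℕ → ℕ → List ℕ → List (ℕ × ℕ)
leafEdges L j []       = []
leafEdges L j (a ∷ as) = (L + j , a) ∷ leafEdges L (suc j) as

caterpillar : ℕ → List ℕ → Graph
caterpillar L as = record { N = L + length as ; edges = spineEdges L ++ leafEdges L 0 as }

-- B₁(m,d,x): spine u_{-d} … u_d, where u_i is spine index i + d.
-- k = (m - (2d+1) - 1)/2 ; leaves at u_{-d-1+x} (index x-1), u_{d+1-x}
-- (index 2d+1-x), and u_{-(k-1)},…,u_{k-1} (indices d+1-k, …, d+k-1).

kB : ℕ → ℕ → ℕ
kB m d = Data.Nat._/_ (m ∸ (2 * d + 1) ∸ 1) 2

B1leaves : ℕ → ℕ → ℕ → List ℕ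
B1leaves m d x = (x ∸ 1) ∷ (2 * d + 1 ∸ x) ∷
                 map (λ i → (d + 1 ∸ kB m d) + i) (upTo (2 * kB m d ∸ 1))

B1 : ℕ → ℕ → ℕ → Graph
B1 m d x = caterpillar (2 * d + 1) (B1leaves m d x)

-- G₃(n,d,x,s): B₁(n-1,d,x) with one extra leaf at u_s (spine index d + s)
G3 : ℕ → ℕ → ℕ → ℕ → Graph
G3 n d x s = caterpillar (2 * d + 1) (B1leaves (n ∸ 1) d x ++ (d + s) ∷ [])

-- The parameter conditions for B₁(m,d,x) to be defined:
-- m even, m ≥ 18, d,x ≥ 1, ⌈(m-2)/4⌉ ≤ d (⇔ m ≤ 4d+2), d ≤ (m-8)/2 (⇔ 2d+8 ≤ m),
-- x ≤ (4+4d-m)/2 (⇔ 2x + m ≤ 4 + 4d).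
record B1Params (m d x : ℕ) : Set where
  field
    m-even : Data.Nat._%_ m 2 ≡ 0
    m≥18   : 18 Data.Nat.≤ m
    d≥1    : 1 Data.Nat.≤ d
    x≥1    : 1 Data.Nat.≤ x
    d-lo   : m Data.Nat.≤ 4 * d + 2
    d-hi   : 2 * d + 8 Data.Nat.≤ m
    x-hi   : 2 * x + m Data.Nat.≤ 4 + 4 * d

-- G₃(n,d,x,1) and G₃(n,d,x,0) arise from B = B₁(n-1,d,x) by attaching one new leaf ℓ at the
-- spine vertex c = u₁, resp. c = u₀, so W(G₃) = W(B) + Σ_v d(v,ℓ).  In a caterpillar
-- d(v,ℓ) = |π v - c| + depth v + 1, where π v is the spine vertex nearest to v.  Moving c one
-- step along the spine raises this by one for the vertices with π v ≤ c and lowers it by one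
-- for the others; in B the former outnumber the latter by exactly two (d+k+2 against d+k).
-- The distance formula is proved by checking that it satisfies the conditions that
-- characterise the breadth-first layers of a graph.

module Submission where

open import Defs
open import Data.Nat using (ℕ; zero; suc; s≤s⁻¹; _+_; _*_; _∸_; _%_; _/_; _⊓_; _⊔_; _≤_; _<_; _≟_; _<?_; _≤?_; z≤n; s≤s; z<s; s<s; ∣_-_∣; _≡ᵇ_)
open import Data.Nat.Properties
open import Data.Nat.DivMod using (/-monoˡ-≤; m*n/n≡m)
open import Data.Nat.Solver using (module +-*-Solver)
open +-*-Solver
open import Data.List using (List; []; _∷_; _++_; map; upTo; applyUpTo; concatMap; length)
open import Data.List.Properties using (map-upTo; map-cong; map-∘; length-++; length-map; length-upTo)
open import Data.Nat.ListAction using (sum)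
open import Data.Nat.ListAction.Properties using (sum-++)
open import Data.Bool using (Bool; true; false; T; _∧_; _∨_)
open import Data.Bool.Properties using (T-∨; T-∧)
open import Data.Unit using (tt)
open import Data.Empty using (⊥-elim)
open import Data.Product using (_×_; _,_; ∃-syntax)
open import Data.Sum using (_⊎_; inj₁; inj₂; [_,_]′)
import Data.Sum as Sum
open import Data.List.Relation.Unary.Any as Any using (here; there)
open import Data.List.Membership.Propositional using (_∈_)
open import Data.List.Relation.Unary.All using (All; []; _∷_)
import Data.List.Relation.Unary.All.Properties as All
import Data.List.Relation.Unary.Any.Properties as Anyₚ
open Anyₚ using (any⁺; any⁻; applyUpTo⁺; applyUpTo⁻; Any-⊎⁻; ++⁺ˡ; ++⁺ʳ; ++⁻)
open import Function using (_∘_; _⇔_; mk⇔; Equivalence)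
open import Relation.Binary using (Tri; tri<; tri≈; tri>)
open import Relation.Nullary using (yes; no)
open import Relation.Nullary.Decidable using (toSum)
open import Algebra.Properties.CommutativeSemigroup +-commutativeSemigroup using () renaming (interchange to +-interchange)
open import Relation.Binary.PropositionalEquality using (_≡_; _≢_; refl; sym; trans; cong; cong₂; subst; subst₂; module ≡-Reasoning)

-- Finite sums and Iverson brackets

sumTo : ℕ → (ℕ → ℕ) → ℕ
sumTo n h = sum (applyUpTo h n)

syntax sumTo n (λ i → e) = ∑[ i < n ] e

sumTo-cong : ∀ n {g h : ℕ → ℕ} → (∀ {i} → i < n → g i ≡ h i) → sumTo n g ≡ sumTo n h
sumTo-cong zero    eq = refl
sumTo-cong (suc n) eq = cong₂ _+_ (eq z<s) (sumTo-cong n (eq ∘ s<s))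

sumTo-suc : ∀ n (h : ℕ → ℕ) → sumTo (suc n) h ≡ sumTo n h + h n
sumTo-suc zero    h = +-identityʳ (h 0)
sumTo-suc (suc n) h = trans (cong (h 0 +_) (sumTo-suc n (h ∘ suc))) (sym (+-assoc (h 0) _ _))

sumTo-+ : ∀ m n (h : ℕ → ℕ) → sumTo (m + n) h ≡ sumTo m h + sumTo n (λ i → h (m + i))
sumTo-+ zero    n h = refl
sumTo-+ (suc m) n h = trans (cong (h 0 +_) (sumTo-+ m n (h ∘ suc))) (sym (+-assoc (h 0) _ _))

sumTo-distrib : ∀ n (g h : ℕ → ℕ) → ∑[ i < n ] (g i + h i) ≡ sumTo n g + sumTo n h
sumTo-distrib zero    g h = refl
sumTo-distrib (suc n) g h = begin
  g 0 + h 0 + sumTo n (λ i → g (suc i) + h (suc i))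
    ≡⟨ cong (g 0 + h 0 +_) (sumTo-distrib n (g ∘ suc) (h ∘ suc)) ⟩
  g 0 + h 0 + (sumTo n (g ∘ suc) + sumTo n (h ∘ suc))
    ≡⟨ +-interchange (g 0) (h 0) _ _ ⟩
  g 0 + sumTo n (g ∘ suc) + (h 0 + sumTo n (h ∘ suc)) ∎
  where open ≡-Reasoning

sumTo-const : ∀ n c → ∑[ i < n ] c ≡ n * c
sumTo-const zero    c = refl
sumTo-const (suc n) c = cong (c +_) (sumTo-const n c)

sumTo-*ˡ : ∀ n k (h : ℕ → ℕ) → ∑[ i < n ] (k * h i) ≡ k * sumTo n h
sumTo-*ˡ zero    k h = sym (*-zeroʳ k)
sumTo-*ˡ (suc n) k h = trans (cong (k * h 0 +_) (sumTo-*ˡ n k (h ∘ suc))) (sym (*-distribˡ-+ k (h 0) _))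

sum-concatMap : ∀ {A : Set} (f : A → List ℕ) xs → sum (concatMap f xs) ≡ sum (map (sum ∘ f) xs)
sum-concatMap f []       = refl
sum-concatMap f (x ∷ xs) = trans (sum-++ (f x) (concatMap f xs)) (cong (sum (f x) +_) (sum-concatMap f xs))

wiener≡∑∑ : ∀ G → wiener G ≡ ∑[ v < N G ] ∑[ u < v ] dist G u v
wiener≡∑∑ G = begin
  sum (concatMap row (upTo (N G)))  ≡⟨ sum-concatMap row (upTo (N G)) ⟩
  sum (map (sum ∘ row) (upTo (N G))) ≡⟨ cong sum (map-cong (λ v → cong sum (map-upTo (λ u → dist G u v) v)) (upTo (N G))) ⟩
  sum (map (λ v → ∑[ u < v ] dist G u v) (upTo (N G))) ≡⟨ cong sum (map-upTo _ (N G)) ⟩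
  ∑[ v < N G ] ∑[ u < v ] dist G u v ∎
  where
  open ≡-Reasoning
  row : ℕ → List ℕ
  row v = map (λ u → dist G u v) (upTo v)

[_≤_] : ℕ → ℕ → ℕ
[ zero  ≤ _     ] = 1
[ suc p ≤ zero  ] = 0
[ suc p ≤ suc q ] = [ p ≤ q ]

p≤q⇒[p≤q]≡1 : ∀ {p q} → p ≤ q → [ p ≤ q ] ≡ 1
p≤q⇒[p≤q]≡1 z≤n       = refl
p≤q⇒[p≤q]≡1 (s≤s p≤q) = p≤q⇒[p≤q]≡1 p≤q

q<p⇒[p≤q]≡0 : ∀ {p q} → q < p → [ p ≤ q ] ≡ 0
q<p⇒[p≤q]≡0 {suc p} {zero}  _         = refl
q<p⇒[p≤q]≡0 {suc p} {suc q} (s<s q<p) = q<p⇒[p≤q]≡0 q<p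

∣p-1+q∣+1≡∣p-q∣+2[p≤q] : ∀ p q → ∣ p - suc q ∣ + 1 ≡ ∣ p - q ∣ + 2 * [ p ≤ q ]
∣p-1+q∣+1≡∣p-q∣+2[p≤q] zero    q       = sym (+-suc q 1)
∣p-1+q∣+1≡∣p-q∣+2[p≤q] (suc p) zero    = trans (cong (_+ 1) (∣-∣-identityʳ p)) (trans (+-comm p 1) (sym (+-identityʳ (suc p))))
∣p-1+q∣+1≡∣p-q∣+2[p≤q] (suc p) (suc q) = ∣p-1+q∣+1≡∣p-q∣+2[p≤q] p q

p≤q⇒∣p-1+q∣≡1+∣p-q∣ : ∀ {p q} → p ≤ q → ∣ p - suc q ∣ ≡ suc ∣ p - q ∣
p≤q⇒∣p-1+q∣≡1+∣p-q∣ {p} {q} p≤q = +-cancelʳ-≡ 1 _ _ (begin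
  ∣ p - suc q ∣ + 1         ≡⟨ ∣p-1+q∣+1≡∣p-q∣+2[p≤q] p q ⟩
  ∣ p - q ∣ + 2 * [ p ≤ q ]    ≡⟨ cong (λ c → ∣ p - q ∣ + 2 * c) (p≤q⇒[p≤q]≡1 p≤q) ⟩
  ∣ p - q ∣ + 2             ≡⟨ +-suc ∣ p - q ∣ 1 ⟩
  suc ∣ p - q ∣ + 1         ∎)
  where open ≡-Reasoning

q<p⇒1+∣p-1+q∣≡∣p-q∣ : ∀ {p q} → q < p → suc ∣ p - suc q ∣ ≡ ∣ p - q ∣
q<p⇒1+∣p-1+q∣≡∣p-q∣ {p} {q} q<p = begin
  suc ∣ p - suc q ∣         ≡⟨ +-comm 1 _ ⟩
  ∣ p - suc q ∣ + 1         ≡⟨ ∣p-1+q∣+1≡∣p-q∣+2[p≤q] p q ⟩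
  ∣ p - q ∣ + 2 * [ p ≤ q ]    ≡⟨ cong (λ c → ∣ p - q ∣ + 2 * c) (q<p⇒[p≤q]≡0 q<p) ⟩
  ∣ p - q ∣ + 0             ≡⟨ +-identityʳ _ ⟩
  ∣ p - q ∣                 ∎
  where open ≡-Reasoning

∑[a+i≤q]≡n⊓[1+q∸a] : ∀ n a q → ∑[ i < n ] [ a + i ≤ q ] ≡ n ⊓ (suc q ∸ a)
∑[a+i≤q]≡n⊓[1+q∸a] zero    a       q       = refl
∑[a+i≤q]≡n⊓[1+q∸a] (suc n) zero    zero    = cong suc (trans (sumTo-const n 0) (trans (*-zeroʳ n) (sym (⊓-zeroʳ n))))
∑[a+i≤q]≡n⊓[1+q∸a] (suc n) zero    (suc q) = cong suc (∑[a+i≤q]≡n⊓[1+q∸a] n zero q)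
∑[a+i≤q]≡n⊓[1+q∸a] (suc n) (suc a) zero    = trans (sumTo-const (suc n) 0) (trans (*-zeroʳ n) (cong (suc n ⊓_) (sym (0∸n≡0 a))))
∑[a+i≤q]≡n⊓[1+q∸a] (suc n) (suc a) (suc q) = ∑[a+i≤q]≡n⊓[1+q∸a] (suc n) a q

-- Certifying the graph distance

distFrom-least : ∀ {G u v F} → (∀ k → T (reach G k u v) ⇔ F ≤ k) →
                 ∀ fuel k → k ≤ F → F ≤ k + fuel → distFrom G u v k fuel ≡ F
distFrom-least {F = F} spec zero k k≤F F≤k = ≤-antisym k≤F (subst (F ≤_) (+-identityʳ k) F≤k)
distFrom-least {G} {u} {v} {F} spec (suc fuel) k k≤F F≤k+1+fuel with reach G k u v in reached
... | true  = ≤-antisym k≤F (Equivalence.to (spec k) (subst T (sym reached) tt))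
... | false = distFrom-least spec fuel (suc k) k<F (subst (F ≤_) (+-suc k fuel) F≤k+1+fuel)
  where
  k<F : k < F
  k<F = ≤∧≢⇒< k≤F (λ k≡F → subst T reached (Equivalence.from (spec k) (≤-reflexive (sym k≡F))))

record IsDistance (G : Graph) (δ : ℕ → ℕ → ℕ) : Set where
  field
    δ-refl  : ∀ u → δ u u ≡ 0
    δ-pos   : ∀ {u v} → u ≢ v → 0 < δ u v
    δ-edge  : ∀ u {w v} → T (adj G w v) → δ u v ≤ suc (δ u w)
    δ-back  : ∀ {u v} → u < N G → v < N G → u ≢ v → ∃[ w ] w < N G × T (adj G w v) × δ u w < δ u v
    -- needed only because dist searches with fuel N G
    δ-bound : ∀ {u v} → u < N G → v < N G → δ u v ≤ N G

module _ {G : Graph} {δ : ℕ → ℕ → ℕ} (isDistance : IsDistance G δ) where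
  open IsDistance isDistance

  reach⇔ : ∀ k {u v} → u < N G → v < N G → T (reach G k u v) ⇔ δ u v ≤ k
  reach⇔ zero {u} {v} _ _ = mk⇔ to from
    where
    to : T (u ≡ᵇ v) → δ u v ≤ 0
    to u≡ᵇv rewrite ≡ᵇ⇒≡ u v u≡ᵇv = ≤-reflexive (δ-refl v)
    from : δ u v ≤ 0 → T (u ≡ᵇ v)
    from δ≤0 with u ≟ v
    ... | yes u≡v = ≡⇒≡ᵇ u v u≡v
    ... | no  u≢v = ⊥-elim (<⇒≱ (δ-pos u≢v) δ≤0)
  reach⇔ (suc k) {u} {v} u<N v<N = mk⇔ to from
    where
    step : ℕ → Bool
    step w = reach G k u w ∧ adj G w v
    to : T (reach G (suc k) u v) → δ u v ≤ suc k
    to r with Equivalence.to T-∨ r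
    ... | inj₁ rₖ = m≤n⇒m≤1+n (Equivalence.to (reach⇔ k u<N v<N) rₖ)
    ... | inj₂ s with applyUpTo⁻ (λ w → w) (any⁻ step (upTo (N G)) s)
    ...   | w , w<N , sʷ with Equivalence.to T-∧ sʷ
    ...     | rʷ , e = ≤-trans (δ-edge u e) (s≤s (Equivalence.to (reach⇔ k u<N w<N) rʷ))
    from : δ u v ≤ suc k → T (reach G (suc k) u v)
    from δ≤1+k with δ u v ≤? k
    ... | yes δ≤k = Equivalence.from T-∨ (inj₁ (Equivalence.from (reach⇔ k u<N v<N) δ≤k))
    ... | no  δ≰k with u ≟ v
    ...   | yes refl = ⊥-elim (δ≰k (subst (_≤ k) (sym (δ-refl u)) z≤n))
    ...   | no  u≢v with δ-back u<N v<N u≢v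
    ...     | w , w<N , e , closer = Equivalence.from T-∨ (inj₂ (any⁺ step (applyUpTo⁺ (λ w → w)
                (Equivalence.from T-∧ (Equivalence.from (reach⇔ k u<N w<N) (s≤s⁻¹ (≤-trans closer δ≤1+k)) , e)) w<N)))

  dist≡ : ∀ {u v} → u < N G → v < N G → dist G u v ≡ δ u v
  dist≡ u<N v<N = distFrom-least (λ k → reach⇔ k u<N v<N) (N G) 0 z≤n (δ-bound u<N v<N)

-- Caterpillars

adj⇔∈ : ∀ G {u v} → T (adj G u v) ⇔ ((u , v) ∈ edges G ⊎ (v , u) ∈ edges G)
adj⇔∈ G {u} {v} = mk⇔ (Any-⊎⁻ ∘ Any.map joins ∘ any⁻ joins? (edges G)) (any⁺ joins? ∘ [ Any.map forward , Any.map backward ]′)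
  where
  joins? : ℕ × ℕ → Bool
  joins? (a , b) = ((a ≡ᵇ u) ∧ (b ≡ᵇ v)) ∨ ((a ≡ᵇ v) ∧ (b ≡ᵇ u))
  joins : ∀ {e} → T (joins? e) → (u , v) ≡ e ⊎ (v , u) ≡ e
  joins {a , b} t with Equivalence.to T-∨ t
  ... | inj₁ t′ with Equivalence.to T-∧ t′
  ...   | a≡u , b≡v = inj₁ (sym (cong₂ _,_ (≡ᵇ⇒≡ a u a≡u) (≡ᵇ⇒≡ b v b≡v)))
  joins {a , b} t | inj₂ t′ with Equivalence.to T-∧ t′
  ...   | a≡v , b≡u = inj₂ (sym (cong₂ _,_ (≡ᵇ⇒≡ a v a≡v) (≡ᵇ⇒≡ b u b≡u)))
  forward : ∀ {e} → (u , v) ≡ e → T (joins? e)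
  forward refl = Equivalence.from T-∨ (inj₁ (Equivalence.from T-∧ (≡⇒≡ᵇ u u refl , ≡⇒≡ᵇ v v refl)))
  backward : ∀ {e} → (v , u) ≡ e → T (joins? e)
  backward refl = Equivalence.from T-∨ (inj₂ (Equivalence.from T-∧ (≡⇒≡ᵇ v v refl , ≡⇒≡ᵇ u u refl)))

nth : List ℕ → ℕ → ℕ
nth []       _       = 0
nth (a ∷ as) zero    = a
nth (a ∷ as) (suc j) = nth as j

data CatEdge (L : ℕ) (as : List ℕ) : ℕ → ℕ → Set where
  spine : ∀ {i} → suc i < L → CatEdge L as i (suc i)
  leaf  : ∀ {j} → j < length as → CatEdge L as (L + j) (nth as j)

module _ {L : ℕ} where

  ∈-leafEdges⁻ : ∀ {a b} j as → (a , b) ∈ leafEdges L j as →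
                 ∃[ i ] i < length as × a ≡ L + (j + i) × b ≡ nth as i
  ∈-leafEdges⁻ j (c ∷ as) (here refl) = 0 , z<s , cong (L +_) (sym (+-identityʳ j)) , refl
  ∈-leafEdges⁻ j (c ∷ as) (there p) with ∈-leafEdges⁻ (suc j) as p
  ... | i , i<n , refl , refl = suc i , s<s i<n , cong (L +_) (sym (+-suc j i)) , refl

  ∈-leafEdges⁺ : ∀ j as {i} → i < length as → (L + (j + i) , nth as i) ∈ leafEdges L j as
  ∈-leafEdges⁺ j (c ∷ as) {zero}  _         = here (cong (λ t → L + t , c) (+-identityʳ j))
  ∈-leafEdges⁺ j (c ∷ as) {suc i} (s<s i<n) =
    there (subst (λ t → (L + t , nth as i) ∈ leafEdges L (suc j) as) (sym (+-suc j i)) (∈-leafEdges⁺ (suc j) as i<n))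

  ∈-caterpillar⇔ : ∀ {as a b} → (a , b) ∈ edges (caterpillar L as) ⇔ CatEdge L as a b
  ∈-caterpillar⇔ {as} = mk⇔ to from
    where
    to : ∀ {a b} → (a , b) ∈ edges (caterpillar L as) → CatEdge L as a b
    to p with ++⁻ (spineEdges L) p
    ... | inj₁ q with applyUpTo⁻ (λ i → i) (Anyₚ.map⁻ q)
    ...   | i , i<L-1 , refl = spine (pred-cancel-< i<L-1)
    to p | inj₂ q with ∈-leafEdges⁻ 0 as q
    ...   | j , j<n , refl , refl = leaf j<n
    from : ∀ {a b} → CatEdge L as a b → (a , b) ∈ edges (caterpillar L as)
    from (spine i+1<L) = ++⁺ˡ (Anyₚ.map⁺ (applyUpTo⁺ (λ i → i) refl (suc[m]≤n⇒m≤pred[n] i+1<L)))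
    from (leaf j<n)    = ++⁺ʳ (spineEdges L) (∈-leafEdges⁺ 0 as j<n)

adj-caterpillar : ∀ {L as u v} → T (adj (caterpillar L as) u v) ⇔ (CatEdge L as u v ⊎ CatEdge L as v u)
adj-caterpillar {L} {as} = mk⇔
  (Sum.map (Equivalence.to ∈-caterpillar⇔) (Equivalence.to ∈-caterpillar⇔) ∘ Equivalence.to (adj⇔∈ (caterpillar L as)))
  (Equivalence.from (adj⇔∈ (caterpillar L as)) ∘ Sum.map (Equivalence.from ∈-caterpillar⇔) (Equivalence.from ∈-caterpillar⇔))

spinePos : ℕ → List ℕ → ℕ → ℕ
spinePos L as u with u <? L
... | yes _ = u
... | no  _ = nth as (u ∸ L)

depth : ℕ → ℕ → ℕ
depth L u with u <? L
... | yes _ = 0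
... | no  _ = 1

data Vertex (L : ℕ) : ℕ → Set where
  onSpine : ∀ {u} → u < L → Vertex L u
  leafAt  : ∀ j → Vertex L (L + j)

vertex : ∀ L u → Vertex L u
vertex L u with u <? L
... | yes u<L = onSpine u<L
... | no  u≮L = subst (Vertex L) (m+[n∸m]≡n (≮⇒≥ u≮L)) (leafAt (u ∸ L))

depth≤1 : ∀ L u → depth L u ≤ 1
depth≤1 L u with u <? L
... | yes _ = z≤n
... | no  _ = ≤-refl

viaSpine : ℕ → List ℕ → ℕ → ℕ → ℕ
viaSpine L as u v = ∣ spinePos L as u - spinePos L as v ∣ + depth L u + depth L v

catDist : ℕ → List ℕ → ℕ → ℕ → ℕ
catDist L as u v with u ≟ v
... | yes _ = 0
... | no  _ = viaSpine L as u v

All-nth : ∀ {P : ℕ → Set} {as} → All P as → ∀ {j} → j < length as → P (nth as j)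
All-nth (p ∷ ps) {zero}  _         = p
All-nth (p ∷ ps) {suc j} (s<s j<n) = All-nth ps j<n

module _ (L : ℕ) (as : List ℕ) where

  spinePos-spine : ∀ {u} → u < L → spinePos L as u ≡ u
  spinePos-spine {u = u} u<L with u <? L
  ... | yes _   = refl
  ... | no  u≮L = ⊥-elim (u≮L u<L)

  spinePos-leaf : ∀ j → spinePos L as (L + j) ≡ nth as j
  spinePos-leaf j with L + j <? L
  ... | yes L+j<L = ⊥-elim (m+n≮m L j L+j<L)
  ... | no  _     = cong (nth as) (m+n∸m≡n L j)

  depth-spine : ∀ {u} → u < L → depth L u ≡ 0
  depth-spine {u} u<L with u <? L
  ... | yes _   = refl
  ... | no  u≮L = ⊥-elim (u≮L u<L)

  depth-leaf : ∀ j → depth L (L + j) ≡ 1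
  depth-leaf j with L + j <? L
  ... | yes L+j<L = ⊥-elim (m+n≮m L j L+j<L)
  ... | no  _     = refl

  catDist-refl : ∀ u → catDist L as u u ≡ 0
  catDist-refl u with u ≟ u
  ... | yes _   = refl
  ... | no  u≢u = ⊥-elim (u≢u refl)

  catDist-≢ : ∀ {u v} → u ≢ v → catDist L as u v ≡ viaSpine L as u v
  catDist-≢ {u} {v} u≢v with u ≟ v
  ... | yes u≡v = ⊥-elim (u≢v u≡v)
  ... | no  _   = refl

  catDist≤viaSpine : ∀ u v → catDist L as u v ≤ viaSpine L as u v
  catDist≤viaSpine u v with u ≟ v
  ... | yes _ = z≤n
  ... | no  _ = ≤-refl

  viaSpine-comm : ∀ u v → viaSpine L as u v ≡ viaSpine L as v u
  viaSpine-comm u v = begin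
    ∣ p u - p v ∣ + depth L u + depth L v   ≡⟨ +-assoc _ (depth L u) (depth L v) ⟩
    ∣ p u - p v ∣ + (depth L u + depth L v) ≡⟨ cong₂ _+_ (∣-∣-comm (p u) (p v)) (+-comm (depth L u) (depth L v)) ⟩
    ∣ p v - p u ∣ + (depth L v + depth L u) ≡⟨ sym (+-assoc _ (depth L v) (depth L u)) ⟩
    ∣ p v - p u ∣ + depth L v + depth L u   ∎
    where
    open ≡-Reasoning
    p = spinePos L as

  catDist-triangle : ∀ u w v → catDist L as u v ≤ catDist L as u w + catDist L as w v
  catDist-triangle u w v with toSum (u ≟ w) | toSum (w ≟ v)
  ... | inj₁ refl | _         = subst (λ t → catDist L as u v ≤ t + catDist L as u v) (sym (catDist-refl u)) ≤-refl
  ... | inj₂ _    | inj₁ refl = subst (λ t → catDist L as u w ≤ catDist L as u w + t) (sym (catDist-refl w)) (m≤m+n _ 0)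
  ... | inj₂ u≢w  | inj₂ w≢v  = begin
    catDist L as u v                          ≤⟨ catDist≤viaSpine u v ⟩
    ∣ p u - p v ∣ + du + dv                    ≤⟨ +-monoˡ-≤ dv (+-monoˡ-≤ du (∣-∣-triangle (p u) (p w) (p v))) ⟩
    ∣ p u - p w ∣ + ∣ p w - p v ∣ + du + dv    ≤⟨ m≤m+n _ (dw + dw) ⟩
    ∣ p u - p w ∣ + ∣ p w - p v ∣ + du + dv + (dw + dw)
      ≡⟨ solve 5 (λ a b du dv dw → a :+ b :+ du :+ dv :+ (dw :+ dw) := (a :+ du :+ dw) :+ (b :+ dw :+ dv))
               refl ∣ p u - p w ∣ ∣ p w - p v ∣ du dv dw ⟩
    viaSpine L as u w + viaSpine L as w v     ≡⟨ sym (cong₂ _+_ (catDist-≢ u≢w) (catDist-≢ w≢v)) ⟩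
    catDist L as u w + catDist L as w v       ∎
    where
    open ≤-Reasoning
    p = spinePos L as
    du = depth L u
    dv = depth L v
    dw = depth L w

  viaSpine-spine : ∀ u {v} → v < L → viaSpine L as u v ≡ ∣ spinePos L as u - v ∣ + depth L u
  viaSpine-spine u v<L = trans (cong₂ (λ a b → ∣ spinePos L as u - a ∣ + depth L u + b) (spinePos-spine v<L) (depth-spine v<L))
                               (+-identityʳ _)

  viaSpine-leaf : ∀ u j → viaSpine L as u (L + j) ≡ ∣ spinePos L as u - nth as j ∣ + depth L u + 1
  viaSpine-leaf u j = cong₂ (λ a b → ∣ spinePos L as u - a ∣ + depth L u + b) (spinePos-leaf j) (depth-leaf j)

  viaSpine-pos : ∀ {u v} → u ≢ v → 0 < viaSpine L as u v
  viaSpine-pos {u} {v} u≢v with vertex L u | vertex L v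
  ... | leafAt j    | _           = ≤-trans (≤-reflexive (sym (depth-leaf j))) (≤-trans (m≤n+m _ ∣ spinePos L as (L + j) - spinePos L as v ∣) (m≤m+n _ (depth L v)))
  ... | onSpine _   | leafAt j    = ≤-trans (≤-reflexive (sym (depth-leaf j))) (m≤n+m _ _)
  ... | onSpine u<L | onSpine v<L = subst (0 <_) (sym spineDist) (n≢0⇒n>0 (u≢v ∘ ∣m-n∣≡0⇒m≡n))
    where
    spineDist : viaSpine L as u v ≡ ∣ u - v ∣
    spineDist = trans (viaSpine-spine u v<L)
                      (trans (cong₂ (λ a b → ∣ a - v ∣ + b) (spinePos-spine u<L) (depth-spine u<L)) (+-identityʳ _))

  module _ (as<L : All (_< L) as) where

    private
      G = caterpillar L as
      p = spinePos L as

    spinePos<L : ∀ {u} → u < N G → p u < L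
    spinePos<L {u} u<N with vertex L u
    ... | onSpine u<L = subst (_< L) (sym (spinePos-spine u<L)) u<L
    ... | leafAt j    = subst (_< L) (sym (spinePos-leaf j)) (All-nth as<L (+-cancelˡ-< L j _ u<N))

    viaSpine-edge : ∀ {a b} → CatEdge L as a b → viaSpine L as a b ≡ 1
    viaSpine-edge (spine {i} i+1<L) = begin
      viaSpine L as i (suc i)  ≡⟨ viaSpine-spine i i+1<L ⟩
      ∣ p i - suc i ∣ + depth L i ≡⟨ cong₂ (λ a b → ∣ a - suc i ∣ + b) (spinePos-spine i<L) (depth-spine i<L) ⟩
      ∣ i - suc i ∣ + 0        ≡⟨ cong (_+ 0) (p≤q⇒∣p-1+q∣≡1+∣p-q∣ (≤-refl {i})) ⟩
      suc ∣ i - i ∣ + 0        ≡⟨ cong (λ t → suc t + 0) (∣n-n∣≡0 i) ⟩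
      1 ∎
      where
      open ≡-Reasoning
      i<L = <-trans (n<1+n i) i+1<L
    viaSpine-edge (leaf {j} j<n) = begin
      viaSpine L as (L + j) (nth as j) ≡⟨ viaSpine-spine (L + j) (All-nth as<L j<n) ⟩
      ∣ p (L + j) - nth as j ∣ + depth L (L + j) ≡⟨ cong₂ (λ a b → ∣ a - nth as j ∣ + b) (spinePos-leaf j) (depth-leaf j) ⟩
      ∣ nth as j - nth as j ∣ + 1 ≡⟨ cong (_+ 1) (∣n-n∣≡0 (nth as j)) ⟩
      1 ∎
      where open ≡-Reasoning

    catDist-adj : ∀ {w v} → T (adj G w v) → catDist L as w v ≤ 1
    catDist-adj {w} {v} e = ≤-trans (catDist≤viaSpine w v) (≤-reflexive (edgeLength (Equivalence.to adj-caterpillar e)))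
      where
      edgeLength : CatEdge L as w v ⊎ CatEdge L as v w → viaSpine L as w v ≡ 1
      edgeLength (inj₁ e) = viaSpine-edge e
      edgeLength (inj₂ e) = trans (viaSpine-comm w v) (viaSpine-edge e)

    closerOnSpine : ∀ {u w v} → u ≢ v → w < L → v < L → ∣ p u - w ∣ < ∣ p u - v ∣ →
                    catDist L as u w < catDist L as u v
    closerOnSpine {u} {w} {v} u≢v w<L v<L closer = begin-strict
      catDist L as u w        ≤⟨ catDist≤viaSpine u w ⟩
      viaSpine L as u w       ≡⟨ viaSpine-spine u w<L ⟩
      ∣ p u - w ∣ + depth L u <⟨ +-monoˡ-< (depth L u) closer ⟩
      ∣ p u - v ∣ + depth L u ≡⟨ sym (viaSpine-spine u v<L) ⟩
      viaSpine L as u v       ≡⟨ sym (catDist-≢ u≢v) ⟩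
      catDist L as u v        ∎
      where open ≤-Reasoning

    Predecessor : ℕ → ℕ → Set
    Predecessor u v = ∃[ w ] w < N G × (CatEdge L as w v ⊎ CatEdge L as v w) × catDist L as u w < catDist L as u v

    predecessorOnSpine : ∀ {u v} → u < N G → u ≢ v → v < L → Tri (p u < v) (p u ≡ v) (v < p u) → Predecessor u v
    predecessorOnSpine {u} {zero}  _ _ _ (tri< () _ _)
    predecessorOnSpine {u} {suc v} _ u≢v v+1<L (tri< pu≤v _ _) =
      v , <-≤-trans v<L (m≤m+n L _) , inj₁ (spine v+1<L) ,
      closerOnSpine u≢v v<L v+1<L (≤-reflexive (sym (p≤q⇒∣p-1+q∣≡1+∣p-q∣ (s≤s⁻¹ pu≤v))))
      where v<L = <-trans (n<1+n v) v+1<L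
    predecessorOnSpine {u} {v} u<N u≢v v<L (tri> _ _ v<pu) =
      suc v , <-≤-trans v+1<L (m≤m+n L _) , inj₂ (spine v+1<L) ,
      closerOnSpine u≢v v+1<L v<L (≤-reflexive (q<p⇒1+∣p-1+q∣≡∣p-q∣ v<pu))
      where v+1<L = ≤-<-trans v<pu (spinePos<L u<N)
    predecessorOnSpine {u} {v} u<N u≢v v<L (tri≈ _ pu≡v _) with vertex L u
    ... | onSpine u<L = ⊥-elim (u≢v (trans (sym (spinePos-spine u<L)) pu≡v))
    ... | leafAt j    =
      L + j , u<N , inj₁ (subst (CatEdge L as (L + j)) (trans (sym (spinePos-leaf j)) pu≡v) (leaf (+-cancelˡ-< L j _ u<N))) ,
      subst₂ _<_ (sym (catDist-refl (L + j))) (sym (catDist-≢ u≢v)) (viaSpine-pos u≢v)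

    catDist-predecessor : ∀ {u v} → u < N G → v < N G → u ≢ v → Predecessor u v
    catDist-predecessor {u} {v} u<N v<N u≢v with vertex L v
    ... | onSpine v<L = predecessorOnSpine u<N u≢v v<L (<-cmp (p u) v)
    ... | leafAt j    = nth as j , <-≤-trans (All-nth as<L j<n) (m≤m+n L _) , inj₂ (leaf j<n) , (begin-strict
      catDist L as u (nth as j)         ≤⟨ catDist≤viaSpine u (nth as j) ⟩
      viaSpine L as u (nth as j)        ≡⟨ viaSpine-spine u (All-nth as<L j<n) ⟩
      ∣ p u - nth as j ∣ + depth L u     <⟨ m<m+n _ z<s ⟩
      ∣ p u - nth as j ∣ + depth L u + 1 ≡⟨ sym (viaSpine-leaf u j) ⟩
      viaSpine L as u (L + j)           ≡⟨ sym (catDist-≢ u≢v) ⟩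
      catDist L as u (L + j)            ∎)
      where
      open ≤-Reasoning
      j<n = +-cancelˡ-< L j _ v<N

    catDist≤N : ∀ {u v} → 1 ≤ length as → u < N G → v < N G → catDist L as u v ≤ N G
    catDist≤N {u} {v} 1≤n u<N v<N = begin
      catDist L as u v                ≤⟨ catDist≤viaSpine u v ⟩
      ∣ p u - p v ∣ + depth L u + depth L v ≤⟨ +-mono-≤ (+-monoʳ-≤ ∣ p u - p v ∣ (depth≤1 L u)) (depth≤1 L v) ⟩
      ∣ p u - p v ∣ + 1 + 1           ≡⟨ trans (+-assoc _ 1 1) (+-suc _ 1) ⟩
      suc ∣ p u - p v ∣ + 1           ≤⟨ +-monoˡ-≤ 1 (≤-<-trans (∣m-n∣≤m⊔n (p u) (p v)) (⊔-lub (spinePos<L u<N) (spinePos<L v<N))) ⟩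
      L + 1                           ≤⟨ +-monoʳ-≤ L 1≤n ⟩
      L + length as                   ∎
      where open ≤-Reasoning

    catDist-isDistance : 1 ≤ length as → IsDistance G (catDist L as)
    catDist-isDistance 1≤n = record
      { δ-refl  = catDist-refl
      ; δ-pos   = λ u≢v → subst (0 <_) (sym (catDist-≢ u≢v)) (viaSpine-pos u≢v)
      ; δ-edge  = λ u {w} {v} e → ≤-trans (catDist-triangle u w v) (≤-trans (+-monoʳ-≤ (catDist L as u w) (catDist-adj e)) (≤-reflexive (+-comm _ 1)))
      ; δ-back  = λ u<N v<N u≢v → let w , w<N , e , closer = catDist-predecessor u<N v<N u≢v in w , w<N , Equivalence.from adj-caterpillar e , closer
      ; δ-bound = catDist≤N 1≤n
      }

    dist-caterpillar : ∀ {u v} → 1 ≤ length as → u < N G → v < N G → dist G u v ≡ catDist L as u v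
    dist-caterpillar 1≤n = dist≡ (catDist-isDistance 1≤n)

-- Attaching a leaf to a caterpillar

nth-snoc : ∀ bs c {j} → j < length bs → nth (bs ++ c ∷ []) j ≡ nth bs j
nth-snoc (b ∷ bs) c {zero}  _         = refl
nth-snoc (b ∷ bs) c {suc j} (s<s j<n) = nth-snoc bs c j<n

nth-last : ∀ bs c → nth (bs ++ c ∷ []) (length bs) ≡ c
nth-last []       c = refl
nth-last (b ∷ bs) c = nth-last bs c

spinePos-snoc : ∀ L bs c {u} → u < L + length bs → spinePos L (bs ++ c ∷ []) u ≡ spinePos L bs u
spinePos-snoc L bs c {u} u<N with vertex L u
... | onSpine u<L = trans (spinePos-spine L _ u<L) (sym (spinePos-spine L bs u<L))
... | leafAt j    = trans (spinePos-leaf L _ j) (trans (nth-snoc bs c (+-cancelˡ-< L j _ u<N)) (sym (spinePos-leaf L bs j)))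

catDist-cong : ∀ L as bs u v → spinePos L as u ≡ spinePos L bs u → spinePos L as v ≡ spinePos L bs v →
               catDist L as u v ≡ catDist L bs u v
catDist-cong L as bs u v eqᵘ eqᵛ with u ≟ v
... | yes _ = refl
... | no  _ = cong (λ t → t + depth L u + depth L v) (cong₂ ∣_-_∣ eqᵘ eqᵛ)

transmission : ℕ → List ℕ → ℕ → ℕ
transmission L bs c = ∑[ u < L + length bs ] (∣ spinePos L bs u - c ∣ + depth L u + 1)

wiener-addLeaf : ∀ {L bs c} → All (_< L) bs → 1 ≤ length bs → c < L →
                 wiener (caterpillar L (bs ++ c ∷ [])) ≡ wiener (caterpillar L bs) + transmission L bs c
wiener-addLeaf {L} {bs} {c} bs<L 1≤n c<L = begin
  wiener G′                                          ≡⟨ wiener≡∑∑ G′ ⟩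
  ∑[ v < N G′ ] ∑[ u < v ] dist G′ u v                 ≡⟨ cong (λ n → ∑[ v < n ] ∑[ u < v ] dist G′ u v) N′≡1+N ⟩
  ∑[ v < suc (N G) ] ∑[ u < v ] dist G′ u v            ≡⟨ sumTo-suc (N G) _ ⟩
  ∑[ v < N G ] ∑[ u < v ] dist G′ u v + ∑[ u < N G ] dist G′ u (N G)
    ≡⟨ cong₂ _+_ (sumTo-cong (N G) (λ v<N → sumTo-cong _ (λ u<v → oldPair (<-trans u<v v<N) v<N)))
                 (sumTo-cong (N G) newPair) ⟩
  ∑[ v < N G ] ∑[ u < v ] dist G u v + transmission L bs c ≡⟨ cong (_+ transmission L bs c) (sym (wiener≡∑∑ G)) ⟩
  wiener G + transmission L bs c                       ∎
  where
  open ≡-Reasoning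
  G  = caterpillar L bs
  G′ = caterpillar L (bs ++ c ∷ [])
  bs′<L : All (_< L) (bs ++ c ∷ [])
  bs′<L = All.++⁺ bs<L (c<L ∷ [])
  1≤n′ : 1 ≤ length (bs ++ c ∷ [])
  1≤n′ = subst (1 ≤_) (sym (length-++ bs)) (≤-trans 1≤n (m≤m+n _ 1))
  N′≡1+N : N G′ ≡ suc (N G)
  N′≡1+N = trans (cong (L +_) (trans (length-++ bs) (+-comm _ 1))) (+-suc L _)
  old<N′ : ∀ {u} → u < N G → u < N G′
  old<N′ {u} u<N = subst (u <_) (sym N′≡1+N) (m<n⇒m<1+n u<N)
  oldPair : ∀ {u v} → u < N G → v < N G → dist G′ u v ≡ dist G u v
  oldPair {u} {v} u<N v<N = begin
    dist G′ u v       ≡⟨ dist-caterpillar L _ bs′<L 1≤n′ (old<N′ u<N) (old<N′ v<N) ⟩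
    catDist L _ u v   ≡⟨ catDist-cong L _ bs u v (spinePos-snoc L bs c u<N) (spinePos-snoc L bs c v<N) ⟩
    catDist L bs u v  ≡⟨ sym (dist-caterpillar L bs bs<L 1≤n u<N v<N) ⟩
    dist G u v        ∎
  newPair : ∀ {u} → u < N G → dist G′ u (N G) ≡ ∣ spinePos L bs u - c ∣ + depth L u + 1
  newPair {u} u<N = begin
    dist G′ u (N G)        ≡⟨ dist-caterpillar L _ bs′<L 1≤n′ (old<N′ u<N) (subst (N G <_) (sym N′≡1+N) (n<1+n (N G))) ⟩
    catDist L _ u (N G)    ≡⟨ catDist-≢ L _ (<⇒≢ u<N) ⟩
    viaSpine L _ u (L + length bs) ≡⟨ viaSpine-leaf L _ u (length bs) ⟩
    ∣ spinePos L (bs ++ c ∷ []) u - nth (bs ++ c ∷ []) (length bs) ∣ + depth L u + 1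
      ≡⟨ cong₂ (λ a b → ∣ a - b ∣ + depth L u + 1) (spinePos-snoc L bs c u<N) (nth-last bs c) ⟩
    ∣ spinePos L bs u - c ∣ + depth L u + 1 ∎

-- Moving the new leaf along the spine

sumTo-nth : ∀ as (h : ℕ → ℕ) → ∑[ j < length as ] h (nth as j) ≡ sum (map h as)
sumTo-nth []       h = refl
sumTo-nth (a ∷ as) h = cong (h a +_) (sumTo-nth as h)

sumTo-spinePos : ∀ L as (h : ℕ → ℕ) → ∑[ u < L + length as ] h (spinePos L as u) ≡ sumTo L h + sum (map h as)
sumTo-spinePos L as h = begin
  ∑[ u < L + length as ] h (spinePos L as u)                            ≡⟨ sumTo-+ L (length as) _ ⟩
  ∑[ u < L ] h (spinePos L as u) + ∑[ j < length as ] h (spinePos L as (L + j))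
    ≡⟨ cong₂ _+_ (sumTo-cong L (cong h ∘ spinePos-spine L as)) (sumTo-cong (length as) (λ {j} _ → cong h (spinePos-leaf L as j))) ⟩
  sumTo L h + ∑[ j < length as ] h (nth as j)                           ≡⟨ cong (sumTo L h +_) (sumTo-nth as h) ⟩
  sumTo L h + sum (map h as)                                            ∎
  where open ≡-Reasoning

countAtMost : ℕ → List ℕ → ℕ → ℕ
countAtMost L as c = ∑[ u < L + length as ] [ spinePos L as u ≤ c ]

transmission-suc : ∀ L as c → transmission L as (suc c) + (L + length as) ≡ transmission L as c + 2 * countAtMost L as c
transmission-suc L as c = begin
  transmission L as (suc c) + n                      ≡⟨ cong (transmission L as (suc c) +_) (sym (trans (sumTo-const n 1) (*-identityʳ n))) ⟩
  transmission L as (suc c) + ∑[ u < n ] 1           ≡⟨ sym (sumTo-distrib n _ _) ⟩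
  ∑[ u < n ] (∣ p u - suc c ∣ + depth L u + 1 + 1)   ≡⟨ sumTo-cong n (λ {u} _ → shift (p u) (depth L u)) ⟩
  ∑[ u < n ] (∣ p u - c ∣ + depth L u + 1 + 2 * [ p u ≤ c ]) ≡⟨ sumTo-distrib n _ _ ⟩
  transmission L as c + ∑[ u < n ] (2 * [ p u ≤ c ])  ≡⟨ cong (transmission L as c +_) (sumTo-*ˡ n 2 _) ⟩
  transmission L as c + 2 * countAtMost L as c       ∎
  where
  open ≡-Reasoning
  n = L + length as
  p = spinePos L as
  shift : ∀ q l → ∣ q - suc c ∣ + l + 1 + 1 ≡ ∣ q - c ∣ + l + 1 + 2 * [ q ≤ c ]
  shift q l = begin
    ∣ q - suc c ∣ + l + 1 + 1        ≡⟨ solve 2 (λ a l → a :+ l :+ con 1 :+ con 1 := (a :+ con 1) :+ (l :+ con 1)) refl ∣ q - suc c ∣ l ⟩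
    (∣ q - suc c ∣ + 1) + (l + 1)    ≡⟨ cong (_+ (l + 1)) (∣p-1+q∣+1≡∣p-q∣+2[p≤q] q c) ⟩
    (∣ q - c ∣ + 2 * [ q ≤ c ]) + (l + 1) ≡⟨ solve 3 (λ a x l → (a :+ x) :+ (l :+ con 1) := a :+ l :+ con 1 :+ x) refl ∣ q - c ∣ (2 * [ q ≤ c ]) l ⟩
    ∣ q - c ∣ + l + 1 + 2 * [ q ≤ c ]   ∎

-- The caterpillar B₁

module _ {m d x : ℕ} (1≤x : 1 ≤ x) (x≤d : x ≤ d) (1≤k : 1 ≤ kB m d) (k≤d : kB m d ≤ d) where

  private
    k     = kB m d
    k′    = k ∸ 1
    L     = 2 * d + 1
    low   = d + 1 ∸ k
    M     = 2 * k ∸ 1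
    bs    = B1leaves m d x

    1+k′≡k : suc k′ ≡ k
    1+k′≡k = m+[n∸m]≡n 1≤k

    M≡k+k′ : M ≡ k + k′
    M≡k+k′ = begin
      2 * k ∸ 1        ≡⟨ cong (λ t → 2 * t ∸ 1) (sym 1+k′≡k) ⟩
      2 * suc k′ ∸ 1   ≡⟨ solve 1 (λ k′ → k′ :+ (con 1 :+ k′ :+ con 0) := con 1 :+ k′ :+ k′) refl k′ ⟩
      suc k′ + k′      ≡⟨ cong (_+ k′) 1+k′≡k ⟩
      k + k′           ∎
      where open ≡-Reasoning

    low+k≡1+d : low + k ≡ suc d
    low+k≡1+d = trans (m∸n+n≡m (≤-trans k≤d (m≤m+n d 1))) (+-comm d 1)

    L≡1+d+d : L ≡ suc d + d
    L≡1+d+d = solve 1 (λ d → con 2 :* d :+ con 1 := con 1 :+ d :+ d) refl d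

    d<L : d < L
    d<L = subst (d <_) (sym L≡1+d+d) (s≤s (m≤m+n d d))

    d<L∸x : d < L ∸ x
    d<L∸x = begin-strict
      d         <⟨ n<1+n d ⟩
      suc d     ≡⟨ sym (trans (cong (_∸ d) L≡1+d+d) (m+n∸n≡m (suc d) d)) ⟩
      L ∸ d     ≤⟨ ∸-monoʳ-≤ L x≤d ⟩
      L ∸ x     ∎
      where open ≤-Reasoning

    central<L : ∀ {i} → i < M → low + i < L
    central<L {i} i<M = begin-strict
      low + i       <⟨ +-monoʳ-< low i<M ⟩
      low + M       ≡⟨ trans (cong (low +_) M≡k+k′) (sym (+-assoc low k k′)) ⟩
      low + k + k′  ≡⟨ cong (_+ k′) low+k≡1+d ⟩
      suc d + k′    ≤⟨ +-monoʳ-≤ (suc d) (≤-trans (m∸n≤m k 1) k≤d) ⟩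
      suc d + d     ≡⟨ sym L≡1+d+d ⟩
      L             ∎
      where open ≤-Reasoning

    1+d∸low≡k : suc d ∸ low ≡ k
    1+d∸low≡k = trans (cong (_∸ low) (+-comm 1 d)) (m∸[m∸n]≡n (≤-trans k≤d (m≤m+n d 1)))

    sum-central : ∀ (h : ℕ → ℕ) → sum (map h (map (low +_) (upTo M))) ≡ ∑[ i < M ] h (low + i)
    sum-central h = cong sum (trans (sym (map-∘ (upTo M))) (map-upTo (h ∘ (low +_)) M))

  B1leaves<L : All (_< L) bs
  B1leaves<L = ≤-<-trans (m∸n≤m x 1) (≤-<-trans x≤d d<L)
             ∷ ∸-monoʳ-< 1≤x (≤-trans x≤d (<⇒≤ d<L))
             ∷ All.map⁺ (All.applyUpTo⁺₁ (λ i → i) M central<L)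

  B1-order : L + length bs ≡ 2 * (d + k + 1)
  B1-order = begin
    L + suc (suc (length (map (low +_) (upTo M)))) ≡⟨ cong (λ n → L + suc (suc n)) (trans (length-map _ (upTo M)) (length-upTo M)) ⟩
    L + suc (suc M)                                  ≡⟨ cong (λ n → L + suc (suc n)) (trans M≡k+k′ (cong (_+ k′) (sym 1+k′≡k))) ⟩
    L + suc (suc (suc k′ + k′))                       ≡⟨ solve 2 (λ d k′ → con 2 :* d :+ con 1 :+ (con 3 :+ k′ :+ k′) := con 2 :* (d :+ (con 1 :+ k′) :+ con 1)) refl d k′ ⟩
    2 * (d + suc k′ + 1)                             ≡⟨ cong (λ t → 2 * (d + t + 1)) 1+k′≡k ⟩
    2 * (d + k + 1)                                  ∎
    where open ≡-Reasoning

  -- the spine vertices u₋d … u₀, the leaf at u₋d₋₁₊ₓ and the k central leaves at u₋₍ₖ₋₁₎ … u₀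
  B1-countAtMost : countAtMost L bs d ≡ d + k + 2
  B1-countAtMost = begin
    countAtMost L bs d                                   ≡⟨ sumTo-spinePos L bs (λ a → [ a ≤ d ]) ⟩
    ∑[ u < L ] [ u ≤ d ] + ([ x ∸ 1 ≤ d ] + ([ L ∸ x ≤ d ] + sum (map (λ a → [ a ≤ d ]) (map (low +_) (upTo M)))))
      ≡⟨ cong₂ _+_ (∑[a+i≤q]≡n⊓[1+q∸a] L 0 d) (cong₂ _+_ (p≤q⇒[p≤q]≡1 (≤-trans (m∸n≤m x 1) x≤d)) (cong₂ _+_ (q<p⇒[p≤q]≡0 d<L∸x) (sum-central (λ a → [ a ≤ d ])))) ⟩
    L ⊓ suc d + (1 + (0 + ∑[ i < M ] [ low + i ≤ d ]))    ≡⟨ cong (λ t → L ⊓ suc d + (1 + t)) (∑[a+i≤q]≡n⊓[1+q∸a] M low d) ⟩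
    L ⊓ suc d + (1 + M ⊓ (suc d ∸ low))                ≡⟨ cong₂ (λ a b → a + (1 + M ⊓ b)) (m≥n⇒m⊓n≡n d<L) 1+d∸low≡k ⟩
    suc d + (1 + M ⊓ k)                                  ≡⟨ cong (λ t → suc d + (1 + t)) (m≥n⇒m⊓n≡n (subst (k ≤_) (sym M≡k+k′) (m≤m+n k k′))) ⟩
    suc d + (1 + k)                                      ≡⟨ solve 2 (λ d k → con 1 :+ d :+ (con 1 :+ k) := d :+ k :+ con 2) refl d k ⟩
    d + k + 2                                            ∎
    where open ≡-Reasoning

  B1-transmission-suc : transmission L bs (suc d) ≡ transmission L bs d + 2
  B1-transmission-suc = +-cancelʳ-≡ (L + length bs) _ _ (begin
    transmission L bs (suc d) + (L + length bs)   ≡⟨ transmission-suc L bs d ⟩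
    transmission L bs d + 2 * countAtMost L bs d  ≡⟨ cong (λ c → transmission L bs d + 2 * c) B1-countAtMost ⟩
    transmission L bs d + 2 * (d + k + 2)         ≡⟨ solve 3 (λ t d k → t :+ con 2 :* (d :+ k :+ con 2) := t :+ con 2 :+ con 2 :* (d :+ k :+ con 1)) refl (transmission L bs d) d k ⟩
    transmission L bs d + 2 + 2 * (d + k + 1)     ≡⟨ cong (transmission L bs d + 2 +_) (sym B1-order) ⟩
    transmission L bs d + 2 + (L + length bs)     ∎)
    where open ≡-Reasoning

module _ {m d x : ℕ} (params : B1Params m d x) where
  open B1Params params

  private
    numerator≡m∸[2d+2] : m ∸ (2 * d + 1) ∸ 1 ≡ m ∸ (2 * d + 2)
    numerator≡m∸[2d+2] = trans (∸-+-assoc m (2 * d + 1) 1) (cong (m ∸_) (+-assoc (2 * d) 1 1))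

  B1Params⇒x≤d : x ≤ d
  B1Params⇒x≤d = *-cancelˡ-≤ 2 (≤-trans (m≤m+n (2 * x) 4) (+-cancelʳ-≤ (2 * d + 4) (2 * x + 4) (2 * d) bound))
    where
    bound : 2 * x + 4 + (2 * d + 4) ≤ 2 * d + (2 * d + 4)
    bound = subst₂ _≤_ (solve 2 (λ x d → con 2 :* x :+ (con 2 :* d :+ con 8) := con 2 :* x :+ con 4 :+ (con 2 :* d :+ con 4)) refl x d)
                       (solve 1 (λ d → con 4 :+ con 4 :* d := con 2 :* d :+ (con 2 :* d :+ con 4)) refl d)
                       (≤-trans (+-monoʳ-≤ (2 * x) d-hi) x-hi)

  B1Params⇒1≤k : 1 ≤ kB m d
  B1Params⇒1≤k = /-monoˡ-≤ {2} 2 (subst (2 ≤_) (sym numerator≡m∸[2d+2]) (begin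
    2                              ≤⟨ m≤m+n 2 4 ⟩
    6                              ≡⟨ sym (m+n∸m≡n (2 * d + 2) 6) ⟩
    2 * d + 2 + 6 ∸ (2 * d + 2)    ≡⟨ cong (_∸ (2 * d + 2)) (solve 1 (λ d → con 2 :* d :+ con 2 :+ con 6 := con 2 :* d :+ con 8) refl d) ⟩
    2 * d + 8 ∸ (2 * d + 2)        ≤⟨ ∸-monoˡ-≤ (2 * d + 2) d-hi ⟩
    m ∸ (2 * d + 2)                ∎))
    where open ≤-Reasoning

  B1Params⇒k≤d : kB m d ≤ d
  B1Params⇒k≤d = ≤-trans (/-monoˡ-≤ {n = 2 * d} 2 (subst (_≤ 2 * d) (sym numerator≡m∸[2d+2]) (begin
    m ∸ (2 * d + 2)                ≤⟨ ∸-monoˡ-≤ (2 * d + 2) d-lo ⟩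
    4 * d + 2 ∸ (2 * d + 2)        ≡⟨ cong (_∸ (2 * d + 2)) (solve 1 (λ d → con 4 :* d :+ con 2 := con 2 :* d :+ (con 2 :* d :+ con 2)) refl d) ⟩
    2 * d + (2 * d + 2) ∸ (2 * d + 2) ≡⟨ m+n∸n≡m (2 * d) (2 * d + 2) ⟩
    2 * d                          ∎)))
    (≤-reflexive (trans (cong (_/ 2) (*-comm 2 d)) (m*n/n≡m d 2)))
    where open ≤-Reasoning

mainTheorem10 : (n d x : ℕ) → n % 2 ≡ 1 → B1Params (n ∸ 1) d x →
    wiener (G3 n d x 1) ≡ wiener (G3 n d x 0) + 2
mainTheorem10 n d x _ params = begin
  wiener (G3 n d x 1)                     ≡⟨ wiener-addLeaf bs<L (s≤s z≤n) (centre<L 1 (B1Params.d≥1 params)) ⟩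
  wiener B + transmission L bs (d + 1)    ≡⟨ cong (λ c → wiener B + transmission L bs c) (+-comm d 1) ⟩
  wiener B + transmission L bs (suc d)    ≡⟨ cong (wiener B +_) (B1-transmission-suc x≥1 x≤d 1≤k k≤d) ⟩
  wiener B + (transmission L bs d + 2)    ≡⟨ cong (λ c → wiener B + (transmission L bs c + 2)) (sym (+-identityʳ d)) ⟩
  wiener B + (transmission L bs (d + 0) + 2) ≡⟨ sym (+-assoc (wiener B) _ 2) ⟩
  wiener B + transmission L bs (d + 0) + 2  ≡⟨ cong (_+ 2) (sym (wiener-addLeaf bs<L (s≤s z≤n) (centre<L 0 z≤n))) ⟩
  wiener (G3 n d x 0) + 2                 ∎
  where
  open ≡-Reasoning
  open B1Params params using (x≥1)
  m  = n ∸ 1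
  L  = 2 * d + 1
  bs = B1leaves m d x
  B  = B1 m d x
  x≤d = B1Params⇒x≤d params
  1≤k = B1Params⇒1≤k params
  k≤d = B1Params⇒k≤d params
  bs<L = B1leaves<L x≥1 x≤d 1≤k k≤d
  centre<L : ∀ s → s ≤ d → d + s < L
  centre<L s s≤d = ≤-trans (s≤s (+-monoʳ-≤ d s≤d)) (≤-reflexive (solve 1 (λ d → con 1 :+ (d :+ d) := con 2 :* d :+ con 1) refl d))
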